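{- Let $G$ be a graph and $m \geq 5$ an integer. Suppose that every set of $\lfloor m/3 \rfloor$ vertices of $G$ contains two distinct vertices that have a common neighbour in $G$. If $G$ contains a cycle of length at least $m$, then $G$ contains a cycle whose length lies between $\lceil m/2 \rceil$ and $m-1$ (inclusive). -}

module Defs where

open import Data.Nat using (ℕ; suc; _≤_)
open import Data.Fin using (Fin; toℕ)
open import Data.Product using (∃; _×_)
open import Function.Definitions using (Injective)
open import Relation.Binary.PropositionalEquality using (_≡_)
open import Relation.Nullary using (¬_)

record Graph (n : ℕ) : Set₁ where
  field
    Adj     : Fin n → Fin n → Set
    sym     : ∀ {u v} → Adj u v → Adj v u
    irrefl  : ∀ {v} → ¬ Adj v v
open Graph public

record Cycle {n : ℕ} (G : Graph n) (k : ℕ) : Set where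
  field
    length≥3 : 3 ≤ k
    vert     : Fin k → Fin n
    distinct : Injective _≡_ _≡_ vert
    step     : ∀ (i j : Fin k) → suc (toℕ i) ≡ toℕ j → Adj G (vert i) (vert j)
    close    : ∀ (i j : Fin k) → suc (toℕ i) ≡ k → toℕ j ≡ 0 → Adj G (vert i) (vert j)

HasCycle : ∀ {n} → Graph n → ℕ → Set
HasCycle G k = Cycle G k

CommonNeighbour : ∀ {n} → Graph n → Fin n → Fin n → Set
CommonNeighbour G u v = ∃ λ w → Adj G u w × Adj G v w

EverySetHasCommonNbrPair : ∀ {n} → Graph n → ℕ → Set
EverySetHasCommonNbrPair {n} G s =
  ∀ (S : Fin s → Fin n) → Injective _≡_ _≡_ S →
    ∃ λ i → ∃ λ j → ¬ i ≡ j × CommonNeighbour G (S i) (S j)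

module Submission where

-- Walk around a cycle of length k ≥ m and look at the ⌊m/3⌋ vertices at positions 0, 3, 6, …
-- By hypothesis two of them, at positions p and q, have a common neighbour w, and p and q are at
-- distance at least 3 along the cycle in both directions. If w is off the cycle, each of the two
-- arcs between p and q closes up through w; if w is on the cycle, it is next to at most one of
-- p and q, so one of its two edges is a chord. Either way the cycle splits into two shorter
-- cycles whose lengths add up to at least k + 2. If one of them still has length at least m we
-- repeat; otherwise both are shorter than m, and they cannot both be shorter than ⌈m/2⌉.

open import Defs hiding (sym)
open import Data.Empty using (⊥-elim)
open import Function using (_∘_)
open import Function.Definitions using (Injective)
open import Data.Fin using (Fin; toℕ)
open import Data.Fin.Properties using (toℕ-injective; toℕ<n; toℕ-fromℕ<; any?)
import Data.Fin.Properties as Finₚ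
open import Data.Nat
open import Data.Nat.DivMod
open import Data.Nat.Divisibility using (_∣_; divides; ∣⇒≤)
open import Data.Nat.Induction using (<-rec)
open import Data.Nat.Properties
open import Data.Product using (∃; ∃₂; _×_; _,_)
open import Data.Sum using (_⊎_; inj₁; inj₂)
open import Relation.Binary.Definitions using (tri<; tri≈; tri>)
open import Relation.Binary.PropositionalEquality
open import Relation.Nullary using (yes; no)

[1+m]%n≡[1+m%n]%n : ∀ m n .{{_ : NonZero n}} → suc m % n ≡ suc (m % n) % n
[1+m]%n≡[1+m%n]%n m n = begin
  (1 + m) % n                ≡⟨ %-distribˡ-+ 1 m n ⟩
  (1 % n + m % n) % n        ≡⟨ cong (λ r → (1 % n + r) % n) (sym (m%n%n≡m%n m n)) ⟩
  (1 % n + m % n % n) % n    ≡⟨ sym (%-distribˡ-+ 1 (m % n) n) ⟩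
  (1 + m % n) % n            ∎
  where open ≡-Reasoning

m%d≡n%d⇒d∣n∸m : ∀ {m n d} .{{_ : NonZero d}} → m % d ≡ n % d → d ∣ n ∸ m
m%d≡n%d⇒d∣n∸m {m} {n} {d} eq = divides (n / d ∸ m / d) (begin
  n ∸ m                                       ≡⟨ cong₂ _∸_ (m≡m%n+[m/n]*n n d) (m≡m%n+[m/n]*n m d) ⟩
  (n % d + n / d * d) ∸ (m % d + m / d * d)   ≡⟨ cong (λ r → (n % d + n / d * d) ∸ (r + m / d * d)) eq ⟩
  (n % d + n / d * d) ∸ (n % d + m / d * d)   ≡⟨ [m+n]∸[m+o]≡n∸o (n % d) _ _ ⟩
  n / d * d ∸ m / d * d                       ≡⟨ *-distribʳ-∸ d (n / d) (m / d) ⟨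
  (n / d ∸ m / d) * d                         ∎)
  where open ≡-Reasoning

∸-+-∸ : ∀ {s t u} → s ≤ t → t ≤ u → (t ∸ s) + (u ∸ t) ≡ u ∸ s
∸-+-∸ {s} {t} {u} s≤t t≤u = +-cancelˡ-≡ s _ _ (begin
  s + ((t ∸ s) + (u ∸ t))   ≡⟨ +-assoc s (t ∸ s) (u ∸ t) ⟨
  s + (t ∸ s) + (u ∸ t)     ≡⟨ cong (_+ (u ∸ t)) (m+[n∸m]≡n s≤t) ⟩
  t + (u ∸ t)               ≡⟨ m+[n∸m]≡n t≤u ⟩
  u                         ≡⟨ m+[n∸m]≡n (≤-trans s≤t t≤u) ⟨
  s + (u ∸ s)               ∎)
  where open ≡-Reasoning

+-∸-≤ : ∀ c {s t k} → s ≤ t → c + t ≤ s + k → c + (t ∸ s) ≤ k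
+-∸-≤ c {s} {t} {k} s≤t le = begin
  c + (t ∸ s)   ≡⟨ +-∸-assoc c s≤t ⟨
  c + t ∸ s     ≤⟨ ∸-monoˡ-≤ s le ⟩
  s + k ∸ s     ≡⟨ m+n∸m≡n s k ⟩
  k             ∎
  where open ≤-Reasoning

m≤n≤m+o⇒[n∸m]+[m+o∸n]≡o : ∀ {m n o} → m ≤ n → n ≤ m + o → (n ∸ m) + (m + o ∸ n) ≡ o
m≤n≤m+o⇒[n∸m]+[m+o∸n]≡o {m} {o = o} m≤n n≤m+o = trans (∸-+-∸ m≤n n≤m+o) (m+n∸m≡n m o)

<⇒≤∸1 : ∀ {a m} → a < m → a ≤ m ∸ 1
<⇒≤∸1 {a} {m} a<m = subst (a ≤_) (pred[m∸n]≡m∸[1+n] m 0) (suc[m]≤n⇒m≤pred[n] a<m)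

+-<-⌈/2⌉ : ∀ {a b m} → a < ⌈ m /2⌉ → b < ⌈ m /2⌉ → a + b < m
+-<-⌈/2⌉ {a} {b} {m} a< b< = s≤s⁻¹ (begin
  suc (suc (a + b))             ≡⟨ cong suc (+-suc a b) ⟨
  suc a + suc b                 ≤⟨ +-mono-≤ a< b< ⟩
  ⌈ m /2⌉ + ⌈ m /2⌉             ≤⟨ +-monoʳ-≤ ⌈ m /2⌉ (⌊n/2⌋≤⌈n/2⌉ (suc m)) ⟩
  ⌊ suc m /2⌋ + ⌈ suc m /2⌉     ≡⟨ ⌊n/2⌋+⌈n/2⌉≡n (suc m) ⟩
  suc m                         ∎)
  where open ≤-Reasoning

module _ {n : ℕ} (G : Graph n) where

  mkCycle : ∀ {k} (h : ℕ → Fin n) → 3 ≤ k →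
    (∀ {s t} → s < k → t < k → h s ≡ h t → s ≡ t) →
    (∀ {t} → suc t < k → Adj G (h t) (h (suc t))) →
    (∀ {t} → suc t ≡ k → Adj G (h t) (h 0)) →
    Cycle G k
  mkCycle {k} h 3≤k inj step close = record
    { length≥3 = 3≤k
    ; vert     = λ i → h (toℕ i)
    ; distinct = λ {i} {j} → toℕ-injective ∘ inj (toℕ<n i) (toℕ<n j)
    ; step     = λ i j 1+i≡j → subst (λ t → Adj G (h (toℕ i)) (h t)) 1+i≡j
                                  (step (subst (_< k) (sym 1+i≡j) (toℕ<n j)))
    ; close    = λ i j 1+i≡k j≡0 → subst (λ t → Adj G (h (toℕ i)) (h t)) (sym j≡0) (close 1+i≡k)
    }

  ShorterCyclePair : ℕ → Set
  ShorterCyclePair k = ∃₂ λ a b → a < k × b < k × 2 + k ≤ a + b × HasCycle G a × HasCycle G b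

  module Walk {k : ℕ} (C : Cycle G k) where
    open Cycle C

    private instance
      k≢0 : NonZero k
      k≢0 = >-nonZero (≤-trans (s≤s z≤n) length≥3)

    -- Positions along the cycle are taken modulo k, so every arc is a segment a, a + 1, …, a + d
    -- of positions and the cycle never needs to be rotated.
    walk : ℕ → Fin n
    walk t = vert (t mod k)

    walk-cong : ∀ {s t} → s % k ≡ t % k → walk s ≡ walk t
    walk-cong e = cong vert (toℕ-injective (trans (toℕ-fromℕ< _) (trans e (sym (toℕ-fromℕ< _)))))

    walk-toℕ : ∀ i → walk (toℕ i) ≡ vert i
    walk-toℕ i = cong vert (toℕ-injective (trans (toℕ-fromℕ< _) (m<n⇒m%n≡m (toℕ<n i))))

    walk-+k : ∀ t → walk (t + k) ≡ walk t
    walk-+k t = walk-cong ([m+n]%n≡m%n t k)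

    walk-step : ∀ t → Adj G (walk t) (walk (suc t))
    walk-step t with suc (t % k) <? k
    ... | yes 1+r<k = step (t mod k) (suc t mod k) (begin
      suc (toℕ (t mod k))   ≡⟨ cong suc (toℕ-fromℕ< _) ⟩
      suc (t % k)           ≡⟨ m<n⇒m%n≡m 1+r<k ⟨
      suc (t % k) % k       ≡⟨ [1+m]%n≡[1+m%n]%n t k ⟨
      suc t % k             ≡⟨ toℕ-fromℕ< _ ⟨
      toℕ (suc t mod k)     ∎)
      where open ≡-Reasoning
    ... | no 1+r≮k = close (t mod k) (suc t mod k)
      (trans (cong suc (toℕ-fromℕ< _)) 1+r≡k)
      (trans (toℕ-fromℕ< _) (trans ([1+m]%n≡[1+m%n]%n t k) (trans (cong (_% k) 1+r≡k) (n%n≡0 k))))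
      where 1+r≡k = ≤-antisym (m%n<n t k) (≮⇒≥ 1+r≮k)

    walk-step⁺ : ∀ a t → Adj G (walk (a + t)) (walk (a + suc t))
    walk-step⁺ a t = subst (Adj G (walk (a + t)) ∘ walk) (sym (+-suc a t)) (walk-step (a + t))

    walk-injective : ∀ {s t} → walk s ≡ walk t → s % k ≡ t % k
    walk-injective e = trans (sym (toℕ-fromℕ< _)) (trans (cong toℕ (distinct e)) (toℕ-fromℕ< _))

    walk-≡⇒k≤∸ : ∀ a {s t} → s < t → walk (a + s) ≡ walk (a + t) → k ≤ t ∸ s
    walk-≡⇒k≤∸ a {s} {t} s<t e = ∣⇒≤ {{>-nonZero (m<n⇒0<n∸m s<t)}}
      (subst (k ∣_) ([m+n]∸[m+o]≡n∸o a t s) (m%d≡n%d⇒d∣n∸m (walk-injective e)))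

    walk-injectiveOn : ∀ a {s t} → s < k → t < k → walk (a + s) ≡ walk (a + t) → s ≡ t
    walk-injectiveOn a {s} {t} s<k t<k e with <-cmp s t
    ... | tri< s<t _ _ = ⊥-elim (<⇒≱ t<k (≤-trans (walk-≡⇒k≤∸ a s<t e) (m∸n≤m t s)))
    ... | tri≈ _ s≡t _ = s≡t
    ... | tri> _ _ t<s = ⊥-elim (<⇒≱ s<k (≤-trans (walk-≡⇒k≤∸ a t<s (sym e)) (m∸n≤m s t)))

    walk-gap : ∀ {s t} → s ≤ t → walk (s + (t ∸ s)) ≡ walk t
    walk-gap s≤t = cong walk (m+[n∸m]≡n s≤t)

    walk-wrap : ∀ {s t} → t ≤ s + k → walk (t + (s + k ∸ t)) ≡ walk s
    walk-wrap {s} t≤s+k = trans (walk-gap t≤s+k) (walk-+k s)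

    arc : ∀ a d → 2 ≤ d → d < k → Adj G (walk (a + d)) (walk a) → Cycle G (suc d)
    arc a d 2≤d d<k chord = mkCycle (λ t → walk (a + t)) (s≤s 2≤d)
      (λ s≤d t≤d → walk-injectiveOn a (≤-<-trans (s≤s⁻¹ s≤d) d<k) (≤-<-trans (s≤s⁻¹ t≤d) d<k))
      (λ {t} _ → walk-step⁺ a t)
      (λ { refl → subst (Adj G (walk (a + d)) ∘ walk) (sym (+-identityʳ a)) chord })

    OffCycle : Fin n → Set
    OffCycle w = ∀ t → walk t ≢ w

    arc-via : ∀ a d {w} → OffCycle w → 1 ≤ d → d < k →
      Adj G (walk (a + d)) w → Adj G w (walk a) → Cycle G (2 + d)
    arc-via a d {w} off 1≤d d<k end~w w~start = mkCycle h (s≤s (s≤s 1≤d)) h-injective h-step h-close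
      where
      h : ℕ → Fin n
      h zero    = w
      h (suc t) = walk (a + t)

      h-injective : ∀ {s t} → s < 2 + d → t < 2 + d → h s ≡ h t → s ≡ t
      h-injective {zero}  {zero}  _ _ _ = refl
      h-injective {zero}  {suc t} _ _ e = ⊥-elim (off (a + t) (sym e))
      h-injective {suc s} {zero}  _ _ e = ⊥-elim (off (a + s) e)
      h-injective {suc s} {suc t} (s≤s s≤d) (s≤s t≤d) e =
        cong suc (walk-injectiveOn a (≤-<-trans (s≤s⁻¹ s≤d) d<k) (≤-<-trans (s≤s⁻¹ t≤d) d<k) e)

      h-step : ∀ {t} → suc t < 2 + d → Adj G (h t) (h (suc t))
      h-step {zero}  _ = subst (Adj G w ∘ walk) (sym (+-identityʳ a)) w~start
      h-step {suc t} _ = walk-step⁺ a t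

      h-close : ∀ {t} → suc t ≡ 2 + d → Adj G (h t) w
      h-close refl = end~w

    chord-split : ∀ {s t} → 2 + s ≤ t → 2 + t ≤ s + k → Adj G (walk s) (walk t) → ShorterCyclePair k
    chord-split {s} {t} 2+s≤t 2+t≤s+k s~t =
      suc (t ∸ s) , suc (s + k ∸ t) , +-∸-≤ 2 s≤t 2+t≤s+k , +-∸-≤ 2 t≤s+k 2+s+k≤t+k , lengths ,
      arc s (t ∸ s) (m+n≤o⇒m≤o∸n 2 2+s≤t) (+-∸-≤ 1 s≤t (≤-trans (n≤1+n _) 2+t≤s+k))
        (subst (λ v → Adj G v (walk s)) (sym (walk-gap s≤t)) (Graph.sym G s~t)) ,
      arc t (s + k ∸ t) (m+n≤o⇒m≤o∸n 2 2+t≤s+k) (+-∸-≤ 1 t≤s+k (≤-trans (n≤1+n _) 2+s+k≤t+k))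
        (subst (λ v → Adj G v (walk t)) (sym (walk-wrap t≤s+k)) s~t)
      where
      s≤t = ≤-trans (m≤n+m s 2) 2+s≤t
      t≤s+k = ≤-trans (m≤n+m t 2) 2+t≤s+k
      2+s+k≤t+k = +-monoˡ-≤ k 2+s≤t

      lengths : 2 + k ≤ suc (t ∸ s) + suc (s + k ∸ t)
      lengths = ≤-reflexive (cong suc (begin
        suc k                               ≡⟨ cong suc (m≤n≤m+o⇒[n∸m]+[m+o∸n]≡o s≤t t≤s+k) ⟨
        suc ((t ∸ s) + (s + k ∸ t))         ≡⟨ +-suc (t ∸ s) _ ⟨
        (t ∸ s) + suc (s + k ∸ t)           ∎))
        where open ≡-Reasoning

    via-split : ∀ {s t w} → OffCycle w → 3 + s ≤ t → 3 + t ≤ s + k →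
      Adj G (walk s) w → Adj G (walk t) w → ShorterCyclePair k
    via-split {s} {t} {w} off 3+s≤t 3+t≤s+k s~w t~w =
      2 + (t ∸ s) , 2 + (s + k ∸ t) , +-∸-≤ 3 s≤t 3+t≤s+k , +-∸-≤ 3 t≤s+k 3+s+k≤t+k , lengths ,
      arc-via s (t ∸ s) off (m+n≤o⇒m≤o∸n 1 (≤-trans (m≤n+m _ 2) 3+s≤t))
        (+-∸-≤ 1 s≤t (≤-trans (m≤n+m _ 2) 3+t≤s+k))
        (subst (λ v → Adj G v w) (sym (walk-gap s≤t)) t~w) (Graph.sym G s~w) ,
      arc-via t (s + k ∸ t) off (m+n≤o⇒m≤o∸n 1 (≤-trans (m≤n+m _ 2) 3+t≤s+k))
        (+-∸-≤ 1 t≤s+k (≤-trans (m≤n+m _ 2) 3+s+k≤t+k))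
        (subst (λ v → Adj G v w) (sym (walk-wrap t≤s+k)) s~w) (Graph.sym G t~w)
      where
      s≤t = ≤-trans (m≤n+m s 3) 3+s≤t
      t≤s+k = ≤-trans (m≤n+m t 3) 3+t≤s+k
      3+s+k≤t+k = +-monoˡ-≤ k 3+s≤t

      lengths : 2 + k ≤ (2 + (t ∸ s)) + (2 + (s + k ∸ t))
      lengths = s≤s (s≤s (subst (_≤ (t ∸ s) + (2 + (s + k ∸ t)))
        (m≤n≤m+o⇒[n∸m]+[m+o∸n]≡o s≤t t≤s+k) (+-monoʳ-≤ (t ∸ s) (m≤n+m _ 2))))

    short-chord-split : ∀ {s t} → 2 + s ≤ t → 2 + t ≤ k → Adj G (walk s) (walk t) → ShorterCyclePair k
    short-chord-split {s} 2+s≤t 2+t≤k = chord-split 2+s≤t (≤-trans 2+t≤k (m≤n+m k s))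

    -- x is next to at most one of p and q, and its edge to the other one is a chord.
    onCycle-split : ∀ {p q x} → 3 + p ≤ q → 3 + q ≤ k → x < k →
      Adj G (walk p) (walk x) → Adj G (walk q) (walk x) → ShorterCyclePair k
    onCycle-split {p} {q} {x} 3+p≤q 3+q≤k x<k p~x q~x with <-cmp x p | <-cmp x q
    ... | tri≈ _ refl _ | _ = ⊥-elim (irrefl G p~x)
    ... | _ | tri≈ _ refl _ = ⊥-elim (irrefl G q~x)
    ... | tri< x<p _ _ | _ with m≤n⇒m<n∨m≡n x<p
    ...   | inj₁ 2+x≤p = short-chord-split 2+x≤p
                           (≤-trans (≤-trans (n≤1+n _) 3+p≤q) (≤-trans (m≤n+m q 3) 3+q≤k))
                           (Graph.sym G p~x)
    ...   | inj₂ refl  = short-chord-split (≤-trans (m≤n+m _ 2) 3+p≤q) (≤-trans (n≤1+n _) 3+q≤k)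
                           (Graph.sym G q~x)
    onCycle-split {p} {q} {x} 3+p≤q 3+q≤k x<k p~x q~x | tri> _ _ p<x | tri< x<q _ _
      with m≤n⇒m<n∨m≡n p<x
    ...   | inj₁ 2+p≤x = short-chord-split 2+p≤x (≤-trans (s≤s x<q) (≤-trans (m≤n+m _ 2) 3+q≤k)) p~x
    ...   | inj₂ refl  = short-chord-split 3+p≤q (≤-trans (n≤1+n _) 3+q≤k) (Graph.sym G q~x)
    onCycle-split {p} {q} {x} 3+p≤q 3+q≤k x<k p~x q~x | tri> _ _ p<x | tri> _ _ q<x
      with m≤n⇒m<n∨m≡n q<x
    ...   | inj₁ 2+q≤x = chord-split 2+q≤x
                           (≤-trans (s≤s x<k) (+-monoˡ-≤ k (≤-trans (s≤s z≤n) 3+p≤q))) q~x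
    ...   | inj₂ refl  = short-chord-split (≤-trans (m≤n+m _ 1) (≤-trans 3+p≤q (n≤1+n q))) 3+q≤k p~x

    commonNeighbour-split : ∀ {p q w} → 3 + p ≤ q → 3 + q ≤ k →
      Adj G (walk p) w → Adj G (walk q) w → ShorterCyclePair k
    commonNeighbour-split {p} {q} {w} 3+p≤q 3+q≤k p~w q~w with any? (λ i → vert i Finₚ.≟ w)
    ... | yes (i , refl) = onCycle-split 3+p≤q 3+q≤k (toℕ<n i)
      (subst (Adj G (walk p)) (sym (walk-toℕ i)) p~w) (subst (Adj G (walk q)) (sym (walk-toℕ i)) q~w)
    ... | no w∉C = via-split (λ t e → w∉C (t mod k , e)) 3+p≤q (≤-trans 3+q≤k (m≤n+m k p)) p~w q~w

    everyThird-bound : ∀ {r} → r * 3 ≤ k → (i : Fin r) → 3 + toℕ i * 3 ≤ k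
    everyThird-bound r*3≤k i = ≤-trans (*-monoˡ-≤ 3 (toℕ<n i)) r*3≤k

    everyThird-injective : ∀ {r} → r * 3 ≤ k → Injective _≡_ _≡_ (λ (i : Fin r) → walk (toℕ i * 3))
    everyThird-injective r*3≤k {i} {j} e = toℕ-injective (*-cancelʳ-≡ (toℕ i) (toℕ j) 3
      (walk-injectiveOn 0 (<-bound i) (<-bound j) e))
      where
      <-bound : ∀ i → toℕ i * 3 < k
      <-bound i = ≤-trans (m≤n+m _ 2) (everyThird-bound r*3≤k i)

    everyThird-split : ∀ {r w} → r * 3 ≤ k → (i j : Fin r) → i ≢ j →
      Adj G (walk (toℕ i * 3)) w → Adj G (walk (toℕ j * 3)) w → ShorterCyclePair k
    everyThird-split r*3≤k i j i≢j i~w j~w with <-cmp (toℕ i) (toℕ j)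
    ... | tri< i<j _ _ = commonNeighbour-split (*-monoˡ-≤ 3 i<j) (everyThird-bound r*3≤k j) i~w j~w
    ... | tri≈ _ i≡j _ = ⊥-elim (i≢j (toℕ-injective i≡j))
    ... | tri> _ _ j<i = commonNeighbour-split (*-monoˡ-≤ 3 j<i) (everyThird-bound r*3≤k i) j~w i~w

  longCycle-split : ∀ {m k} → EverySetHasCommonNbrPair G (m / 3) → m ≤ k → Cycle G k → ShorterCyclePair k
  longCycle-split {m} H m≤k C =
    let open Walk C
        r*3≤k = ≤-trans (m/n*n≤m m 3) m≤k
        (i , j , i≢j , w , i~w , j~w) = H _ (everyThird-injective r*3≤k)
    in everyThird-split r*3≤k i j i≢j i~w j~w

  shorter-or-medium : ∀ {m k} → m ≤ k → ShorterCyclePair k →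
    (∃ λ k′ → k′ < k × m ≤ k′ × HasCycle G k′) ⊎ (∃ λ l → ⌈ m /2⌉ ≤ l × l ≤ m ∸ 1 × HasCycle G l)
  shorter-or-medium {m} {k} m≤k (a , b , a<k , b<k , 2+k≤a+b , A , B) with m ≤? a | m ≤? b
  ... | yes m≤a | _ = inj₁ (a , a<k , m≤a , A)
  ... | _ | yes m≤b = inj₁ (b , b<k , m≤b , B)
  ... | no m≰a | no m≰b with ⌈ m /2⌉ ≤? a | ⌈ m /2⌉ ≤? b
  ...   | yes ⌈m/2⌉≤a | _ = inj₂ (a , ⌈m/2⌉≤a , <⇒≤∸1 (≰⇒> m≰a) , A)
  ...   | _ | yes ⌈m/2⌉≤b = inj₂ (b , ⌈m/2⌉≤b , <⇒≤∸1 (≰⇒> m≰b) , B)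
  ...   | no ⌈m/2⌉≰a | no ⌈m/2⌉≰b =
    ⊥-elim (<⇒≱ (+-<-⌈/2⌉ (≰⇒> ⌈m/2⌉≰a) (≰⇒> ⌈m/2⌉≰b))
                (≤-trans (≤-trans m≤k (m≤n+m k 2)) 2+k≤a+b))

lemma3p7 : ∀ {n : ℕ} (G : Graph n) (m : ℕ) → 5 ≤ m →
    EverySetHasCommonNbrPair G (m / 3) →
    (∃ λ k → m ≤ k × HasCycle G k) →
    ∃ λ l → ⌈ m /2⌉ ≤ l × l ≤ m ∸ 1 × HasCycle G l
lemma3p7 G m _ H (k , m≤k , C) = <-rec Goal descend k m≤k C
  where
  Goal : ℕ → Set
  Goal k = m ≤ k → HasCycle G k → ∃ λ l → ⌈ m /2⌉ ≤ l × l ≤ m ∸ 1 × HasCycle G l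

  descend : ∀ k → (∀ {k′} → k′ < k → Goal k′) → Goal k
  descend k shorter m≤k C with shorter-or-medium G m≤k (longCycle-split G H m≤k C)
  ... | inj₁ (k′ , k′<k , m≤k′ , C′) = shorter k′<k m≤k′ C′
  ... | inj₂ medium = medium
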